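{- Fix an integer $b>1$. For each positive integer $N$, let $k_N=r+1$, where $r\ge 0$ is the integer with $b^r\mid N$ and $b^{r+1}\nmid N$. Then, as formal power series in $q$, $$\sum_{n=0}^\infty p(n) q^n \equiv \prod_{N=1}^\infty \left(1+q^N+q^{2N}+\cdots+q^{(b-1)N}\right)^{k_N} \pmod{b},$$ where $p(n)$ is the number of partitions of $n$ and the congruence is coefficientwise. That is, for every $n\ge 0$, $p(n)$ is congruent modulo $b$ to the number of partitions of $n$ in which each part size $N$ comes in $k_N$ distinguishable types and each type of part $N$ appears at most $b-1$ times. -}

module Defs where

open import Data.Nat using (ℕ; zero; suc; _+_; _*_; _∸_; _≤?_; _≟_)
open import Data.List using (List; []; _∷_; length; concatMap; map; upTo)
open import Relation.Nullary.Decidable using (does)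
open import Data.Bool using (if_then_else_)

-- Partitions of n, enumerated explicitly.
-- partsFuel fuel n m : all partitions of n into positive parts,
-- written as non-increasing lists, whose largest part is ≤ m.
-- The fuel argument only ensures structural termination; fuel ≥ n suffices.

partsFuel : ℕ → ℕ → ℕ → List (List ℕ)
partsFuel _        zero    _ = [] ∷ []
partsFuel zero     (suc _) _ = []
partsFuel (suc f)  n@(suc _) m =
  concatMap (λ i → let k = suc i in
               if does (k ≤? n)
               then map (k ∷_) (partsFuel f (n ∸ k) k)
               else [])
            (upTo m)

partitions : ℕ → List (List ℕ)
partitions n = partsFuel n n n

p : ℕ → ℕ
p n = length (partitions n)

-- Formal power series in q with ℕ coefficients: n ↦ coefficient of q^n.

Series : Set
Series = ℕ → ℕ

sumBelow : ℕ → (ℕ → ℕ) → ℕ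
sumBelow zero    f = 0
sumBelow (suc n) f = sumBelow n f + f n

one : Series
one zero    = 1
one (suc _) = 0

monomial : ℕ → Series
monomial d m = if does (d ≟ m) then 1 else 0

_⊕_ : Series → Series → Series
(f ⊕ g) n = f n + g n

_⊗_ : Series → Series → Series
(f ⊗ g) n = sumBelow (suc n) (λ i → f i * g (n ∸ i))

_^ˢ_ : Series → ℕ → Series
f ^ˢ zero    = one
f ^ˢ (suc k) = f ⊗ (f ^ˢ k)

geomFactor : ℕ → ℕ → Series
geomFactor b N m = sumBelow b (λ j → monomial (j * N) m)

truncProd : ℕ → (ℕ → ℕ) → ℕ → Series
truncProd b k zero    = one
truncProd b k (suc M) = truncProd b k M ⊗ (geomFactor b (suc M) ^ˢ k (suc M))

-- Over ℕ the identity is in fact exact.  Since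
--   1/(1 − q^N) = (1 + q^N + ⋯ + q^{(b−1)N}) · 1/(1 − q^{bN}),
-- one has, for every M,
--   ∏_{N ≤ M} 1/(1 − q^N) = ∏_{N ≤ M} (1 + ⋯ + q^{(b−1)N})^{k_N} · ∏_{N ≤ M, bN > M} (1 − q^{bN})^{−k_N}.
-- Passing from M − 1 to M, the new factor 1/(1 − q^M) joins the pending factor (1 − q^M)^{−k_{M/b}}
-- (present exactly when b ∣ M) to give (1 − q^M)^{−k_M}, because k_M = k_{M/b} + 1 if b ∣ M and k_M = 1
-- otherwise; that power then splits as above.  The pending factors are 1 up to degree M, so the
-- coefficients of degree ≤ M on both sides coincide, and the congruence modulo b is immediate.

module Submission where

open import Algebra.Bundles using (CommutativeSemigroup)
open import Algebra.Structures using (IsCommutativeMonoid)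
open import Data.Bool using (true; false; if_then_else_)
open import Data.List using (List; []; _∷_; _++_; length; concatMap; map; applyUpTo; upTo)
open import Data.List.Properties using (length-++; length-map)
open import Data.Nat using (ℕ; zero; suc; _+_; _*_; _∸_; _^_; _<_; _≤_; z≤n; s≤s; _≤?_; _<?_; _≟_; NonZero; >-nonZero)
open import Data.Nat.Divisibility
  using (_∣_; divides; _∣?_; _∣0; ∣-refl; ∣-trans; ∣⇒≤; m∣m*n; *-monoʳ-∣; *-cancelˡ-∣; ∣m+n∣m⇒∣n; ∣m∣n⇒∣m+n)
open import Data.Nat.Induction using (<-rec)
open import Data.Nat.Properties
open import Data.Product using (∃-syntax; _×_; _,_)
open import Function using (_∘_)
open import Relation.Binary.Bundles using (Setoid)
open import Relation.Binary.PropositionalEquality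
  using (_≡_; _≢_; refl; sym; trans; cong; cong₂; subst; module ≡-Reasoning)
open import Relation.Nullary using (¬_; Dec; yes; no; does)
open import Relation.Nullary.Decidable using (dec-true; dec-false)
open import Relation.Nullary.Negation using (contradiction)
import Algebra.Properties.CommutativeSemigroup as CommSemigroupProperties
import Relation.Binary.Reasoning.Setoid as SetoidReasoning

open import Defs

private module ℕ+ = CommSemigroupProperties +-commutativeSemigroup

if-yes : ∀ {A B : Set} (d : Dec A) {x y : B} → A → (if does d then x else y) ≡ x
if-yes d a rewrite dec-true d a = refl

if-no : ∀ {A B : Set} (d : Dec A) {x y : B} → ¬ A → (if does d then x else y) ≡ y
if-no d ¬a rewrite dec-false d ¬a = refl

if-does-⇔ : ∀ {A B C : Set} (a? : Dec A) (b? : Dec B) {x y : C} →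
  (A → B) → (B → A) → (if does a? then x else y) ≡ (if does b? then x else y)
if-does-⇔ (yes a) (yes b) A→B B→A = refl
if-does-⇔ (yes a) (no ¬b) A→B B→A = contradiction (A→B a) ¬b
if-does-⇔ (no ¬a) (yes b) A→B B→A = contradiction (B→A b) ¬a
if-does-⇔ (no ¬a) (no ¬b) A→B B→A = refl

sumBelow-cong : ∀ n {f g : ℕ → ℕ} → (∀ i → i < n → f i ≡ g i) → sumBelow n f ≡ sumBelow n g
sumBelow-cong zero    f≡g = refl
sumBelow-cong (suc n) f≡g = cong₂ _+_ (sumBelow-cong n (λ i i<n → f≡g i (m<n⇒m<1+n i<n))) (f≡g n ≤-refl)

sumBelow-zero : ∀ n {f : ℕ → ℕ} → (∀ i → i < n → f i ≡ 0) → sumBelow n f ≡ 0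
sumBelow-zero zero    f≡0 = refl
sumBelow-zero (suc n) f≡0
  rewrite sumBelow-zero n (λ i i<n → f≡0 i (m<n⇒m<1+n i<n)) | f≡0 n ≤-refl = refl

sumBelow-+ : ∀ n (f g : ℕ → ℕ) → sumBelow n (λ i → f i + g i) ≡ sumBelow n f + sumBelow n g
sumBelow-+ zero    f g = refl
sumBelow-+ (suc n) f g rewrite sumBelow-+ n f g = ℕ+.interchange (sumBelow n f) (sumBelow n g) (f n) (g n)

sumBelow-*ˡ : ∀ n c (f : ℕ → ℕ) → sumBelow n (λ i → c * f i) ≡ c * sumBelow n f
sumBelow-*ˡ zero    c f = sym (*-zeroʳ c)
sumBelow-*ˡ (suc n) c f rewrite sumBelow-*ˡ n c f = sym (*-distribˡ-+ c (sumBelow n f) (f n))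

sumBelow-*ʳ : ∀ n c (f : ℕ → ℕ) → sumBelow n (λ i → f i * c) ≡ sumBelow n f * c
sumBelow-*ʳ zero    c f = refl
sumBelow-*ʳ (suc n) c f rewrite sumBelow-*ʳ n c f = sym (*-distribʳ-+ c (sumBelow n f) (f n))

sumBelow-unconsˡ : ∀ n (f : ℕ → ℕ) → sumBelow (suc n) f ≡ f 0 + sumBelow n (f ∘ suc)
sumBelow-unconsˡ zero    f = +-comm 0 (f 0)
sumBelow-unconsˡ (suc n) f rewrite sumBelow-unconsˡ n f = +-assoc (f 0) (sumBelow n (f ∘ suc)) (f (suc n))

sumBelow-reverse : ∀ n (f : ℕ → ℕ) → sumBelow n f ≡ sumBelow n (λ i → f (n ∸ suc i))
sumBelow-reverse zero    f = refl
sumBelow-reverse (suc n) f = begin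
  sumBelow n f + f n                        ≡⟨ +-comm _ (f n) ⟩
  f n + sumBelow n f                        ≡⟨ cong (f n +_) (sumBelow-reverse n f) ⟩
  f n + sumBelow n (λ i → f (n ∸ suc i))    ≡⟨ sumBelow-unconsˡ n (λ i → f (suc n ∸ suc i)) ⟨
  sumBelow (suc n) (λ i → f (suc n ∸ suc i)) ∎
  where open ≡-Reasoning

sumBelow-triangle : ∀ (F : ℕ → ℕ → ℕ) n →
  sumBelow (suc n) (λ i → sumBelow (suc i) (λ j → F j i)) ≡
  sumBelow (suc n) (λ j → sumBelow (suc (n ∸ j)) (λ l → F j (j + l)))
sumBelow-triangle F zero    = refl
sumBelow-triangle F (suc n) = begin
  rows + (column + F (suc n) (suc n))      ≡⟨ cong (_+ (column + F (suc n) (suc n))) (sumBelow-triangle F n) ⟩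
  segments + (column + F (suc n) (suc n))  ≡⟨ +-assoc segments column (F (suc n) (suc n)) ⟨
  segments + column + F (suc n) (suc n)
    ≡⟨ cong₂ _+_ (sumBelow-+ (suc n) _ _) (cong (F (suc n)) (+-identityʳ (suc n))) ⟨
  sumBelow (suc n) (λ j → segment j (n ∸ j) + F j (suc n)) + F (suc n) (suc n + 0)
    ≡⟨ cong₂ _+_ (sumBelow-cong (suc n) extend) (cong (segment (suc n)) (n∸n≡0 (suc n))) ⟨
  sumBelow (suc n) (λ j → segment j (suc n ∸ j)) + segment (suc n) (suc n ∸ suc n) ∎
  where
  open ≡-Reasoning
  segment : ℕ → ℕ → ℕ
  segment j m = sumBelow (suc m) (λ l → F j (j + l))
  rows segments column : ℕ
  rows     = sumBelow (suc n) (λ i → sumBelow (suc i) (λ j → F j i))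
  segments = sumBelow (suc n) (λ j → segment j (n ∸ j))
  column   = sumBelow (suc n) (λ j → F j (suc n))
  extend : ∀ j → j < suc n → segment j (suc n ∸ j) ≡ segment j (n ∸ j) + F j (suc n)
  extend j j<1+n = begin
    segment j (suc n ∸ j)         ≡⟨ cong (segment j) (+-∸-assoc 1 (≤-pred j<1+n)) ⟩
    segment j (suc (n ∸ j))       ≡⟨ cong (λ x → segment j (n ∸ j) + F j x) j+[1+n∸j]≡1+n ⟩
    segment j (n ∸ j) + F j (suc n) ∎
    where
    j+[1+n∸j]≡1+n : j + suc (n ∸ j) ≡ suc n
    j+[1+n∸j]≡1+n = trans (+-suc j (n ∸ j)) (cong suc (m+[n∸m]≡n (≤-pred j<1+n)))

sumBelow-monomial : ∀ L d (g : ℕ → ℕ) → sumBelow L (λ i → monomial d i * g i) ≡ (if does (d <? L) then g d else 0)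
sumBelow-monomial zero    d g = refl
sumBelow-monomial (suc L) d g with d ≟ L
... | yes refl = begin
  sumBelow d (λ i → monomial d i * g i) + monomial d d * g d
    ≡⟨ cong₂ _+_ (sumBelow-zero d (λ i i<d → cong (_* g i) (if-no (d ≟ i) (λ d≡i → <-irrefl (sym d≡i) i<d))))
                 (cong (_* g d) (if-yes (d ≟ d) refl)) ⟩
  g d + 0                                  ≡⟨ +-identityʳ (g d) ⟩
  g d                                      ≡⟨ if-yes (d <? suc d) ≤-refl ⟨
  (if does (d <? suc d) then g d else 0)   ∎
  where open ≡-Reasoning
... | no d≢L = begin
  sumBelow L (λ i → monomial d i * g i) + monomial d L * g L
    ≡⟨ cong₂ _+_ (sumBelow-monomial L d g) (cong (_* g L) (if-no (d ≟ L) d≢L)) ⟩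
  (if does (d <? L) then g d else 0) + 0   ≡⟨ +-identityʳ _ ⟩
  (if does (d <? L) then g d else 0)
    ≡⟨ if-does-⇔ (d <? L) (d <? suc L) m<n⇒m<1+n (λ d<1+L → ≤∧≢⇒< (≤-pred d<1+L) d≢L) ⟩
  (if does (d <? suc L) then g d else 0)   ∎
  where open ≡-Reasoning

infix 4 _≈ˢ_
_≈ˢ_ : Series → Series → Set
f ≈ˢ g = ∀ n → f n ≡ g n

≈ˢ-setoid : Setoid _ _
≈ˢ-setoid = record
  { Carrier       = Series
  ; _≈_           = _≈ˢ_
  ; isEquivalence = record
    { refl  = λ _ → refl
    ; sym   = λ f≈g n → sym (f≈g n)
    ; trans = λ f≈g g≈h n → trans (f≈g n) (g≈h n)
    }
  }

open Setoid ≈ˢ-setoid using () renaming (refl to ≈ˢ-refl; reflexive to ≈ˢ-reflexive; sym to ≈ˢ-sym; trans to ≈ˢ-trans)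

⊕-cong : ∀ {f f′ g g′} → f ≈ˢ f′ → g ≈ˢ g′ → f ⊕ g ≈ˢ f′ ⊕ g′
⊕-cong f≈f′ g≈g′ n = cong₂ _+_ (f≈f′ n) (g≈g′ n)

⊗-cong : ∀ {f f′ g g′} → f ≈ˢ f′ → g ≈ˢ g′ → f ⊗ g ≈ˢ f′ ⊗ g′
⊗-cong f≈f′ g≈g′ n = sumBelow-cong (suc n) (λ i _ → cong₂ _*_ (f≈f′ i) (g≈g′ (n ∸ i)))

⊗-congˡ : ∀ h {f g} → f ≈ˢ g → h ⊗ f ≈ˢ h ⊗ g
⊗-congˡ h = ⊗-cong {h} ≈ˢ-refl

⊗-congʳ : ∀ h {f g} → f ≈ˢ g → f ⊗ h ≈ˢ g ⊗ h
⊗-congʳ h f≈g = ⊗-cong f≈g (≈ˢ-refl {h})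

⊗-comm : ∀ f g → f ⊗ g ≈ˢ g ⊗ f
⊗-comm f g n = begin
  sumBelow (suc n) (λ i → f i * g (n ∸ i))               ≡⟨ sumBelow-reverse (suc n) _ ⟩
  sumBelow (suc n) (λ i → f (n ∸ i) * g (n ∸ (n ∸ i)))   ≡⟨ sumBelow-cong (suc n) swap ⟩
  sumBelow (suc n) (λ i → g i * f (n ∸ i))               ∎
  where
  open ≡-Reasoning
  swap : ∀ i → i < suc n → f (n ∸ i) * g (n ∸ (n ∸ i)) ≡ g i * f (n ∸ i)
  swap i i<1+n rewrite m∸[m∸n]≡n (≤-pred i<1+n) = *-comm (f (n ∸ i)) (g i)

⊗-identityˡ : ∀ f → one ⊗ f ≈ˢ f
⊗-identityˡ f n = begin
  sumBelow (suc n) (λ i → one i * f (n ∸ i))                  ≡⟨ sumBelow-unconsˡ n _ ⟩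
  (f n + 0) + sumBelow n (λ i → one (suc i) * f (n ∸ suc i))  ≡⟨ cong₂ _+_ (+-identityʳ (f n)) (sumBelow-zero n (λ _ _ → refl)) ⟩
  f n + 0                                                     ≡⟨ +-identityʳ (f n) ⟩
  f n                                                         ∎
  where open ≡-Reasoning

⊗-identityʳ : ∀ f → f ⊗ one ≈ˢ f
⊗-identityʳ f = ≈ˢ-trans (⊗-comm f one) (⊗-identityˡ f)

⊗-distribˡ-⊕ : ∀ f g h → f ⊗ (g ⊕ h) ≈ˢ (f ⊗ g) ⊕ (f ⊗ h)
⊗-distribˡ-⊕ f g h n =
  trans (sumBelow-cong (suc n) (λ i _ → *-distribˡ-+ (f i) (g (n ∸ i)) (h (n ∸ i)))) (sumBelow-+ (suc n) _ _)

⊗-distribʳ-⊕ : ∀ f g h → (g ⊕ h) ⊗ f ≈ˢ (g ⊗ f) ⊕ (h ⊗ f)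
⊗-distribʳ-⊕ f g h =
  ≈ˢ-trans (⊗-comm (g ⊕ h) f) (≈ˢ-trans (⊗-distribˡ-⊕ f g h) (⊕-cong (⊗-comm f g) (⊗-comm f h)))

⊗-assoc : ∀ f g h → (f ⊗ g) ⊗ h ≈ˢ f ⊗ (g ⊗ h)
⊗-assoc f g h n = begin
  sumBelow (suc n) (λ i → sumBelow (suc i) (λ j → f j * g (i ∸ j)) * h (n ∸ i))
    ≡⟨ sumBelow-cong (suc n) (λ i _ → sumBelow-*ʳ (suc i) (h (n ∸ i)) _) ⟨
  sumBelow (suc n) (λ i → sumBelow (suc i) (λ j → f j * g (i ∸ j) * h (n ∸ i)))
    ≡⟨ sumBelow-triangle (λ j i → f j * g (i ∸ j) * h (n ∸ i)) n ⟩
  sumBelow (suc n) (λ j → sumBelow (suc (n ∸ j)) (λ l → f j * g (j + l ∸ j) * h (n ∸ (j + l))))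
    ≡⟨ sumBelow-cong (suc n) (λ j _ → sumBelow-cong (suc (n ∸ j)) (λ l _ → reindex j l)) ⟩
  sumBelow (suc n) (λ j → sumBelow (suc (n ∸ j)) (λ l → f j * (g l * h (n ∸ j ∸ l))))
    ≡⟨ sumBelow-cong (suc n) (λ j _ → sumBelow-*ˡ (suc (n ∸ j)) (f j) _) ⟩
  sumBelow (suc n) (λ j → f j * sumBelow (suc (n ∸ j)) (λ l → g l * h (n ∸ j ∸ l))) ∎
  where
  open ≡-Reasoning
  reindex : ∀ j l → f j * g (j + l ∸ j) * h (n ∸ (j + l)) ≡ f j * (g l * h (n ∸ j ∸ l))
  reindex j l rewrite m+n∸m≡n j l | ∸-+-assoc n j l = *-assoc (f j) (g l) (h (n ∸ (j + l)))

⊗-isCommutativeMonoid : IsCommutativeMonoid _≈ˢ_ _⊗_ one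
⊗-isCommutativeMonoid = record
  { isMonoid = record
    { isSemigroup = record
      { isMagma = record { isEquivalence = Setoid.isEquivalence ≈ˢ-setoid ; ∙-cong = ⊗-cong }
      ; assoc   = ⊗-assoc
      }
    ; identity = ⊗-identityˡ , ⊗-identityʳ
    }
  ; comm = ⊗-comm
  }

⊗-commutativeSemigroup : CommutativeSemigroup _ _
⊗-commutativeSemigroup = record
  { isCommutativeSemigroup = IsCommutativeMonoid.isCommutativeSemigroup ⊗-isCommutativeMonoid }

open CommSemigroupProperties ⊗-commutativeSemigroup using (interchange; x∙yz≈y∙xz; xy∙z≈xz∙y)

^ˢ-cong : ∀ {f g} k → f ≈ˢ g → f ^ˢ k ≈ˢ g ^ˢ k
^ˢ-cong zero    f≈g = ≈ˢ-refl
^ˢ-cong (suc k) f≈g = ⊗-cong f≈g (^ˢ-cong k f≈g)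

^ˢ-distrib-⊗ : ∀ f g k → (f ⊗ g) ^ˢ k ≈ˢ (f ^ˢ k) ⊗ (g ^ˢ k)
^ˢ-distrib-⊗ f g zero    = ≈ˢ-sym (⊗-identityˡ one)
^ˢ-distrib-⊗ f g (suc k) = ≈ˢ-trans (⊗-congˡ (f ⊗ g) (^ˢ-distrib-⊗ f g k)) (interchange f g (f ^ˢ k) (g ^ˢ k))

shift : ℕ → Series → Series
shift d f m = if does (d ≤? m) then f (m ∸ d) else 0

shift-≤ : ∀ {d m} f → d ≤ m → shift d f m ≡ f (m ∸ d)
shift-≤ {d} {m} f = if-yes (d ≤? m)

shift-> : ∀ {d m} f → ¬ d ≤ m → shift d f m ≡ 0
shift-> {d} {m} f = if-no (d ≤? m)

monomial-⊗ : ∀ d f → monomial d ⊗ f ≈ˢ shift d f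
monomial-⊗ d f n =
  trans (sumBelow-monomial (suc n) d (λ i → f (n ∸ i))) (if-does-⇔ (d <? suc n) (d ≤? n) ≤-pred s≤s)

monomial-+ : ∀ N d → monomial (N + d) ≈ˢ shift N (monomial d)
monomial-+ N d m with N ≤? m
... | yes N≤m = trans
  (if-does-⇔ (N + d ≟ m) (d ≟ m ∸ N)
    (λ N+d≡m → trans (sym (m+n∸m≡n N d)) (cong (_∸ N) N+d≡m))
    (λ d≡m∸N → trans (cong (N +_) d≡m∸N) (m+[n∸m]≡n N≤m)))
  (sym (shift-≤ (monomial d) N≤m))
... | no N≰m =
  trans (if-no (N + d ≟ m) (λ e → N≰m (subst (N ≤_) e (m≤m+n N d)))) (sym (shift-> (monomial d) N≰m))

monomial-0 : monomial 0 ≈ˢ one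
monomial-0 zero    = refl
monomial-0 (suc m) = refl

sumBelow-shift : ∀ L N (h : ℕ → Series) m →
  sumBelow L (λ j → shift N (h j) m) ≡ shift N (λ m′ → sumBelow L (λ j → h j m′)) m
sumBelow-shift L N h m with N ≤? m
... | yes N≤m = trans (sumBelow-cong L (λ j _ → shift-≤ (h j) N≤m)) (sym (shift-≤ (λ m′ → sumBelow L (λ j → h j m′)) N≤m))
... | no  N≰m = trans (sumBelow-zero L (λ j _ → shift-> (h j) N≰m)) (sym (shift-> (λ m′ → sumBelow L (λ j → h j m′)) N≰m))

geomFactor-telescope : ∀ b N → geomFactor b N ⊕ monomial (b * N) ≈ˢ one ⊕ (monomial N ⊗ geomFactor b N)
geomFactor-telescope b N m = begin
  sumBelow (suc b) (λ j → monomial (j * N) m)                  ≡⟨ sumBelow-unconsˡ b _ ⟩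
  monomial 0 m + sumBelow b (λ j → monomial (N + j * N) m)
    ≡⟨ cong₂ _+_ (monomial-0 m) (sumBelow-cong b (λ j _ → monomial-+ N (j * N) m)) ⟩
  one m + sumBelow b (λ j → shift N (monomial (j * N)) m)      ≡⟨ cong (one m +_) (sumBelow-shift b N (λ j → monomial (j * N)) m) ⟩
  one m + shift N (geomFactor b N) m                           ≡⟨ cong (one m +_) (monomial-⊗ N (geomFactor b N) m) ⟨
  one m + (monomial N ⊗ geomFactor b N) m                      ∎
  where open ≡-Reasoning

-- S = 1/(1 − q^N)
IsGeometric : ℕ → Series → Set
IsGeometric N S = S ≈ˢ one ⊕ (monomial N ⊗ S)

isGeometric-unique : ∀ {N S T} → 1 ≤ N → IsGeometric N S → IsGeometric N T → S ≈ˢ T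
isGeometric-unique {N} {S} {T} N≥1 S-geo T-geo = <-rec (λ m → S m ≡ T m) step
  where
  unfold : ∀ {U} → IsGeometric N U → ∀ m → U m ≡ one m + shift N U m
  unfold {U} U-geo m = trans (U-geo m) (cong (one m +_) (monomial-⊗ N U m))
  step : ∀ m → (∀ {m′} → m′ < m → S m′ ≡ T m′) → S m ≡ T m
  step m ih with N ≤? m
  ... | yes N≤m = begin
    S m                       ≡⟨ unfold S-geo m ⟩
    one m + shift N S m       ≡⟨ cong (one m +_) (shift-≤ S N≤m) ⟩
    one m + S (m ∸ N)         ≡⟨ cong (one m +_) (ih (∸-monoʳ-< N≥1 N≤m)) ⟩
    one m + T (m ∸ N)         ≡⟨ cong (one m +_) (shift-≤ T N≤m) ⟨
    one m + shift N T m       ≡⟨ unfold T-geo m ⟨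
    T m                       ∎
    where open ≡-Reasoning
  ... | no N≰m = begin
    S m                       ≡⟨ unfold S-geo m ⟩
    one m + shift N S m       ≡⟨ cong (one m +_) (trans (shift-> S N≰m) (sym (shift-> T N≰m))) ⟩
    one m + shift N T m       ≡⟨ unfold T-geo m ⟨
    T m                       ∎
    where open ≡-Reasoning

geomSeries : ℕ → Series
geomSeries N m = if does (N ∣? m) then 1 else 0

geomSeries-unfold : ∀ {N} → 1 ≤ N → ∀ m → geomSeries N m ≡ one m + shift N (geomSeries N) m
geomSeries-unfold {N} N≥1 zero = trans (if-yes (N ∣? 0) (N ∣0)) (cong suc (sym (shift-> (geomSeries N) (<⇒≱ N≥1))))
geomSeries-unfold {N} N≥1 (suc m) with N ≤? suc m
... | yes N≤m = trans
  (if-does-⇔ (N ∣? suc m) (N ∣? (suc m ∸ N))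
    (λ N∣m → ∣m+n∣m⇒∣n (subst (N ∣_) (sym (m+[n∸m]≡n N≤m)) N∣m) ∣-refl)
    (λ N∣m∸N → subst (N ∣_) (m+[n∸m]≡n N≤m) (∣m∣n⇒∣m+n ∣-refl N∣m∸N)))
  (sym (shift-≤ (geomSeries N) N≤m))
... | no N≰m = trans (if-no (N ∣? suc m) (N≰m ∘ ∣⇒≤)) (sym (shift-> (geomSeries N) N≰m))

geomSeries-isGeometric : ∀ {N} → 1 ≤ N → IsGeometric N (geomSeries N)
geomSeries-isGeometric {N} N≥1 m =
  trans (geomSeries-unfold N≥1 m) (cong (one m +_) (sym (monomial-⊗ N (geomSeries N) m)))

geomSeries-factor : ∀ b N → 1 ≤ b → 1 ≤ N → geomSeries N ≈ˢ geomFactor b N ⊗ geomSeries (b * N)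
geomSeries-factor b N b≥1 N≥1 = isGeometric-unique N≥1 (geomSeries-isGeometric N≥1) S-isGeometric
  where
  G E S X Y : Series
  G  = geomFactor b N
  E  = geomSeries (b * N)
  S  = G ⊗ E
  X  = monomial N
  Y  = monomial (b * N)
  S⊕Y⊗E : S ⊕ (Y ⊗ E) ≈ˢ (one ⊕ (X ⊗ S)) ⊕ (Y ⊗ E)
  S⊕Y⊗E = begin
    S ⊕ (Y ⊗ E)                   ≈⟨ ⊗-distribʳ-⊕ E G Y ⟨
    (G ⊕ Y) ⊗ E                   ≈⟨ ⊗-congʳ E (geomFactor-telescope b N) ⟩
    (one ⊕ (X ⊗ G)) ⊗ E           ≈⟨ ⊗-distribʳ-⊕ E one (X ⊗ G) ⟩
    (one ⊗ E) ⊕ ((X ⊗ G) ⊗ E)     ≈⟨ ⊕-cong (⊗-identityˡ E) (⊗-assoc X G E) ⟩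
    E ⊕ (X ⊗ S)                   ≈⟨ ⊕-cong (geomSeries-isGeometric (*-mono-≤ b≥1 N≥1)) (≈ˢ-refl {X ⊗ S}) ⟩
    (one ⊕ (Y ⊗ E)) ⊕ (X ⊗ S)     ≈⟨ (λ n → ℕ+.xy∙z≈xz∙y (one n) ((Y ⊗ E) n) ((X ⊗ S) n)) ⟩
    (one ⊕ (X ⊗ S)) ⊕ (Y ⊗ E)     ∎
    where open SetoidReasoning ≈ˢ-setoid
  S-isGeometric : IsGeometric N S
  S-isGeometric n = +-cancelʳ-≡ ((Y ⊗ E) n) (S n) (one n + (X ⊗ S) n) (S⊕Y⊗E n)

prodUpTo : ℕ → (ℕ → Series) → Series
prodUpTo zero    f = one
prodUpTo (suc L) f = prodUpTo L f ⊗ f (suc L)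

partitionSeries : ℕ → Series
partitionSeries M = prodUpTo M geomSeries

partitionSeries-suc : ∀ m n → partitionSeries (suc m) n ≡ partitionSeries m n + shift (suc m) (partitionSeries (suc m)) n
partitionSeries-suc m n = begin
  (P ⊗ E) n                       ≡⟨ ⊗-congˡ P (geomSeries-isGeometric (s≤s z≤n)) n ⟩
  (P ⊗ (one ⊕ (X ⊗ E))) n         ≡⟨ ⊗-distribˡ-⊕ P one (X ⊗ E) n ⟩
  (P ⊗ one) n + (P ⊗ (X ⊗ E)) n   ≡⟨ cong₂ _+_ (⊗-identityʳ P n) (x∙yz≈y∙xz P X E n) ⟩
  P n + (X ⊗ (P ⊗ E)) n           ≡⟨ cong (P n +_) (monomial-⊗ (suc m) (P ⊗ E) n) ⟩
  P n + shift (suc m) (P ⊗ E) n   ∎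
  where
  open ≡-Reasoning
  P E X : Series
  P = partitionSeries m
  E = geomSeries (suc m)
  X = monomial (suc m)

partitionSeries-zero : ∀ m → partitionSeries m 0 ≡ 1
partitionSeries-zero zero    = refl
partitionSeries-zero (suc m) rewrite partitionSeries-suc m 0 | partitionSeries-zero m = refl

partitionSeries-byFirstPart : ∀ m n →
  partitionSeries m (suc n) ≡ sumBelow m (λ i → shift (suc i) (partitionSeries (suc i)) (suc n))
partitionSeries-byFirstPart zero    n = refl
partitionSeries-byFirstPart (suc m) n =
  trans (partitionSeries-suc m (suc n)) (cong (_+ shift (suc m) (partitionSeries (suc m)) (suc n)) (partitionSeries-byFirstPart m n))

length-concatMap-applyUpTo : ∀ {A B : Set} (g : A → List B) (h : ℕ → A) m →
  length (concatMap g (applyUpTo h m)) ≡ sumBelow m (λ i → length (g (h i)))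
length-concatMap-applyUpTo g h zero    = refl
length-concatMap-applyUpTo g h (suc m) = begin
  length (g (h 0) ++ concatMap g (applyUpTo (h ∘ suc) m))     ≡⟨ length-++ (g (h 0)) ⟩
  length (g (h 0)) + length (concatMap g (applyUpTo (h ∘ suc) m))
    ≡⟨ cong (length (g (h 0)) +_) (length-concatMap-applyUpTo g (h ∘ suc) m) ⟩
  length (g (h 0)) + sumBelow m (λ i → length (g (h (suc i))))  ≡⟨ sumBelow-unconsˡ m (λ i → length (g (h i))) ⟨
  sumBelow (suc m) (λ i → length (g (h i)))                      ∎
  where open ≡-Reasoning

length-if : ∀ {A : Set} b (xs : List A) → length (if b then xs else []) ≡ (if b then length xs else 0)
length-if true  xs = refl
length-if false xs = refl

length-partsFuel : ∀ f n m → n ≤ f → length (partsFuel f n m) ≡ partitionSeries m n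
length-partsFuel f       zero    m _         = sym (partitionSeries-zero m)
length-partsFuel (suc f) (suc n) m (s≤s n≤f) = begin
  length (concatMap firstPart (upTo m))                                ≡⟨ length-concatMap-applyUpTo firstPart (λ i → i) m ⟩
  sumBelow m (λ i → length (firstPart i))                              ≡⟨ sumBelow-cong m (λ i _ → length-firstPart i) ⟩
  sumBelow m (λ i → shift (suc i) (partitionSeries (suc i)) (suc n))   ≡⟨ partitionSeries-byFirstPart m n ⟨
  partitionSeries m (suc n)                                            ∎
  where
  open ≡-Reasoning
  firstPart : ℕ → List (List ℕ)
  firstPart i = if does (suc i ≤? suc n) then map (suc i ∷_) (partsFuel f (suc n ∸ suc i) (suc i)) else []
  length-firstPart : ∀ i →
    length (if does (suc i ≤? suc n) then map (suc i ∷_) (partsFuel f (suc n ∸ suc i) (suc i)) else [])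
    ≡ shift (suc i) (partitionSeries (suc i)) (suc n)
  length-firstPart i = trans (length-if (does (suc i ≤? suc n)) _) (cong (λ x → if does (suc i ≤? suc n) then x else 0)
    (trans (length-map (suc i ∷_) (partsFuel f (n ∸ i) (suc i)))
           (length-partsFuel f (n ∸ i) (suc i) (≤-trans (m∸n≤m n i) n≤f))))

partitionSeries-stable : ∀ n d → partitionSeries (n + d) n ≡ partitionSeries n n
partitionSeries-stable n zero    = cong (λ M → partitionSeries M n) (+-identityʳ n)
partitionSeries-stable n (suc d) = begin
  partitionSeries (n + suc d) n      ≡⟨ cong (λ M → partitionSeries M n) (+-suc n d) ⟩
  partitionSeries (suc (n + d)) n    ≡⟨ partitionSeries-suc (n + d) n ⟩
  partitionSeries (n + d) n + shift (suc (n + d)) (partitionSeries (suc (n + d))) n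
    ≡⟨ cong₂ _+_ (partitionSeries-stable n d) (shift-> (partitionSeries (suc (n + d))) (<⇒≱ (s≤s (m≤m+n n d)))) ⟩
  partitionSeries n n + 0            ≡⟨ +-identityʳ _ ⟩
  partitionSeries n n                ∎
  where open ≡-Reasoning

p≡partitionSeries : ∀ {n M} → n ≤ M → p n ≡ partitionSeries M n
p≡partitionSeries {n} {M} n≤M = begin
  p n                          ≡⟨ length-partsFuel n n n ≤-refl ⟩
  partitionSeries n n          ≡⟨ partitionSeries-stable n (M ∸ n) ⟨
  partitionSeries (n + (M ∸ n)) n ≡⟨ cong (λ L → partitionSeries L n) (m+[n∸m]≡n n≤M) ⟩
  partitionSeries M n          ∎
  where open ≡-Reasoning

prodUpTo-cong : ∀ L {f g : ℕ → Series} → (∀ N → 1 ≤ N → N ≤ L → f N ≈ˢ g N) → prodUpTo L f ≈ˢ prodUpTo L g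
prodUpTo-cong zero    f≈g = ≈ˢ-refl
prodUpTo-cong (suc L) f≈g = ⊗-cong (prodUpTo-cong L (λ N N≥1 N≤L → f≈g N N≥1 (m≤n⇒m≤1+n N≤L))) (f≈g (suc L) (s≤s z≤n) ≤-refl)

prodUpTo-extract : ∀ L {f g : ℕ → Series} {N₀} X → 1 ≤ N₀ → N₀ ≤ L →
  (∀ N → 1 ≤ N → N ≤ L → N ≢ N₀ → f N ≈ˢ g N) → f N₀ ≈ˢ g N₀ ⊗ X →
  prodUpTo L f ≈ˢ prodUpTo L g ⊗ X
prodUpTo-extract zero    X N₀≥1 N₀≤0 _ _ = contradiction (≤-trans N₀≥1 N₀≤0) λ ()
prodUpTo-extract (suc L) {f} {g} {N₀} X N₀≥1 N₀≤1+L f≈g fN₀≈gN₀⊗X with N₀ ≟ suc L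
... | yes refl = begin
  prodUpTo L f ⊗ f N₀         ≈⟨ ⊗-cong (prodUpTo-cong L (λ N N≥1 N≤L → f≈g N N≥1 (m≤n⇒m≤1+n N≤L) (<⇒≢ (s≤s N≤L)))) fN₀≈gN₀⊗X ⟩
  prodUpTo L g ⊗ (g N₀ ⊗ X)   ≈⟨ ⊗-assoc (prodUpTo L g) (g N₀) X ⟨
  (prodUpTo L g ⊗ g N₀) ⊗ X   ∎
  where open SetoidReasoning ≈ˢ-setoid
... | no N₀≢1+L = begin
  prodUpTo L f ⊗ f (suc L)     ≈⟨ ⊗-cong (prodUpTo-extract L X N₀≥1 (≤-pred (≤∧≢⇒< N₀≤1+L N₀≢1+L)) f≈g′ fN₀≈gN₀⊗X)
                                         (f≈g (suc L) (s≤s z≤n) ≤-refl (N₀≢1+L ∘ sym)) ⟩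
  (prodUpTo L g ⊗ X) ⊗ g (suc L) ≈⟨ xy∙z≈xz∙y (prodUpTo L g) X (g (suc L)) ⟩
  (prodUpTo L g ⊗ g (suc L)) ⊗ X ∎
  where
  open SetoidReasoning ≈ˢ-setoid
  f≈g′ : ∀ N → 1 ≤ N → N ≤ L → N ≢ N₀ → f N ≈ˢ g N
  f≈g′ N N≥1 N≤L = f≈g N N≥1 (m≤n⇒m≤1+n N≤L)

infix 4 _≈[≤_]_
_≈[≤_]_ : Series → ℕ → Series → Set
f ≈[≤ M ] g = ∀ n → n ≤ M → f n ≡ g n

⊗-cong-≤ : ∀ {M f f′ g g′} → f ≈[≤ M ] f′ → g ≈[≤ M ] g′ → f ⊗ g ≈[≤ M ] f′ ⊗ g′
⊗-cong-≤ f≈f′ g≈g′ n n≤M = sumBelow-cong (suc n) (λ i i≤n →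
  cong₂ _*_ (f≈f′ i (≤-trans (≤-pred i≤n) n≤M)) (g≈g′ (n ∸ i) (≤-trans (m∸n≤m n i) n≤M)))

^ˢ-one-≤ : ∀ {M f} k → f ≈[≤ M ] one → f ^ˢ k ≈[≤ M ] one
^ˢ-one-≤ zero    f≈1 n n≤M = refl
^ˢ-one-≤ (suc k) f≈1 n n≤M = trans (⊗-cong-≤ f≈1 (^ˢ-one-≤ k f≈1) n n≤M) (⊗-identityˡ one n)

prodUpTo-one-≤ : ∀ {M} L (f : ℕ → Series) → (∀ N → 1 ≤ N → N ≤ L → f N ≈[≤ M ] one) → prodUpTo L f ≈[≤ M ] one
prodUpTo-one-≤ zero    f f≈1 n n≤M = refl
prodUpTo-one-≤ (suc L) f f≈1 n n≤M = trans
  (⊗-cong-≤ (prodUpTo-one-≤ L f (λ N N≥1 N≤L → f≈1 N N≥1 (m≤n⇒m≤1+n N≤L))) (f≈1 (suc L) (s≤s z≤n) ≤-refl) n n≤M)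
  (⊗-identityˡ one n)

geomSeries-one-≤ : ∀ {M W} → M < W → geomSeries W ≈[≤ M ] one
geomSeries-one-≤ {W = W} M<W zero    _     = if-yes (W ∣? 0) (W ∣0)
geomSeries-one-≤ {W = W} M<W (suc n) 1+n≤M = if-no (W ∣? suc n) (λ W∣1+n → <⇒≱ M<W (≤-trans (∣⇒≤ W∣1+n) 1+n≤M))

^-monoʳ-∣ : ∀ b {r s} → r ≤ s → b ^ r ∣ b ^ s
^-monoʳ-∣ b {r} {s} r≤s = subst (b ^ r ∣_) b^r*b^[s∸r]≡b^s (m∣m*n (b ^ (s ∸ r)))
  where
  b^r*b^[s∸r]≡b^s : b ^ r * b ^ (s ∸ r) ≡ b ^ s
  b^r*b^[s∸r]≡b^s = trans (sym (^-distribˡ-+-* b r (s ∸ r))) (cong (b ^_) (m+[n∸m]≡n r≤s))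

multiplicity-≤ : ∀ b {r s N} → b ^ r ∣ N → ¬ b ^ suc s ∣ N → r ≤ s
multiplicity-≤ b {r} {s} b^r∣N b^1+s∤N with r ≤? s
... | yes r≤s = r≤s
... | no  r≰s = contradiction (∣-trans (^-monoʳ-∣ b (≰⇒> r≰s)) b^r∣N) b^1+s∤N

module _ (b : ℕ) (b>1 : 1 < b) (k : ℕ → ℕ)
  (k≡1+multiplicity : ∀ N → 1 ≤ N → ∃[ r ] (k N ≡ suc r × (b ^ r) ∣ N × ¬ ((b ^ suc r) ∣ N)))
  where

  private instance
    b-nonZero : NonZero b
    b-nonZero = >-nonZero (<-trans (s≤s z≤n) b>1)

  k-coprime : ∀ N → 1 ≤ N → ¬ b ∣ N → k N ≡ 1
  k-coprime N N≥1 b∤N with k≡1+multiplicity N N≥1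
  ... | r , kN≡1+r , b^r∣N , _ =
    trans kN≡1+r (cong suc (n≤0⇒n≡0 (multiplicity-≤ b b^r∣N (λ b^1∣N → b∤N (subst (_∣ N) (*-identityʳ b) b^1∣N)))))

  k-* : ∀ N → 1 ≤ N → k (b * N) ≡ suc (k N)
  k-* N N≥1 with k≡1+multiplicity N N≥1 | k≡1+multiplicity (b * N) (*-mono-≤ (<⇒≤ b>1) N≥1)
  ... | r , kN≡1+r , b^r∣N , b^1+r∤N | s , kbN≡1+s , b^s∣bN , b^1+s∤bN =
    trans kbN≡1+s (cong suc (trans (≤-antisym s≤1+r 1+r≤s) (sym kN≡1+r)))
    where
    s≤1+r : s ≤ suc r
    s≤1+r = multiplicity-≤ b b^s∣bN (λ b^2+r∣bN → b^1+r∤N (*-cancelˡ-∣ b b^2+r∣bN))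
    1+r≤s : suc r ≤ s
    1+r≤s = multiplicity-≤ b (*-monoʳ-∣ b b^r∣N) b^1+s∤bN

  -- What remains of (1 − q^N)^{−k_N} after splitting off (1 + ⋯ + q^{(b−1)N})^{k_N}; it is merged
  -- into the factor of 1/(1 − q^{bN}) at stage M = bN.
  pending : ℕ → ℕ → Series
  pending M N = if does (M <? b * N) then geomSeries (b * N) ^ˢ k N else one

  pending-< : ∀ {M N} → M < b * N → pending M N ≡ geomSeries (b * N) ^ˢ k N
  pending-< {M} {N} = if-yes (M <? b * N)

  pending-≮ : ∀ {M N} → ¬ M < b * N → pending M N ≡ one
  pending-≮ {M} {N} = if-no (M <? b * N)

  pendingProduct : ℕ → Series
  pendingProduct M = prodUpTo M (pending M)

  pending-suc : ∀ M N → b * N ≢ suc M → pending M N ≡ pending (suc M) N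
  pending-suc M N bN≢1+M = if-does-⇔ (M <? b * N) (suc M <? b * N)
    (λ M<bN → ≤∧≢⇒< M<bN (bN≢1+M ∘ sym)) (λ 1+M<bN → <-trans (n<1+n M) 1+M<bN)

  pendingProduct-step : ∀ M →
    pendingProduct M ⊗ geomSeries (suc M) ≈ˢ prodUpTo M (pending (suc M)) ⊗ (geomSeries (suc M) ^ˢ k (suc M))
  pendingProduct-step M with b ∣? suc M
  ... | no b∤1+M = ⊗-cong
    (prodUpTo-cong M (λ N _ _ → ≈ˢ-reflexive (pending-suc M N (λ bN≡1+M → b∤1+M (subst (b ∣_) bN≡1+M (m∣m*n N))))))
    (λ n → trans (sym (⊗-identityʳ E n)) (cong (λ x → (E ^ˢ x) n) (sym (k-coprime (suc M) (s≤s z≤n) b∤1+M))))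
    where
    E : Series
    E = geomSeries (suc M)
  ... | yes (divides q 1+M≡q*b) = begin
    pendingProduct M ⊗ E         ≈⟨ ⊗-congʳ E (prodUpTo-extract M (E ^ˢ k q) q≥1 q≤M pending-other pending-q) ⟩
    (R′ ⊗ (E ^ˢ k q)) ⊗ E        ≈⟨ ⊗-assoc R′ (E ^ˢ k q) E ⟩
    R′ ⊗ ((E ^ˢ k q) ⊗ E)        ≈⟨ ⊗-congˡ R′ (⊗-comm (E ^ˢ k q) E) ⟩
    R′ ⊗ (E ^ˢ suc (k q))        ≡⟨ cong (λ x → R′ ⊗ (E ^ˢ x)) (sym (trans (cong k (sym bq≡1+M)) (k-* q q≥1))) ⟩
    R′ ⊗ (E ^ˢ k (suc M))        ∎
    where
    open SetoidReasoning ≈ˢ-setoid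
    E R′ : Series
    E  = geomSeries (suc M)
    R′ = prodUpTo M (pending (suc M))
    bq≡1+M : b * q ≡ suc M
    bq≡1+M = trans (*-comm b q) (sym 1+M≡q*b)
    q≥1 : 1 ≤ q
    q≥1 = ≤∧≢⇒< z≤n (λ 0≡q → contradiction (trans 1+M≡q*b (cong (_* b) (sym 0≡q))) λ ())
    q≤M : q ≤ M
    q≤M = ≤-pred (subst (q <_) (sym 1+M≡q*b) (m<m*n q b {{>-nonZero q≥1}} b>1))
    pending-other : ∀ N → 1 ≤ N → N ≤ M → N ≢ q → pending M N ≈ˢ pending (suc M) N
    pending-other N _ _ N≢q = ≈ˢ-reflexive (pending-suc M N (λ bN≡1+M → N≢q (*-cancelˡ-≡ N q b (trans bN≡1+M (sym bq≡1+M)))))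
    pending-q : pending M q ≈ˢ pending (suc M) q ⊗ (E ^ˢ k q)
    pending-q = begin
      pending M q                            ≡⟨ pending-< (subst (M <_) (sym bq≡1+M) (n<1+n M)) ⟩
      geomSeries (b * q) ^ˢ k q              ≡⟨ cong (λ W → geomSeries W ^ˢ k q) bq≡1+M ⟩
      E ^ˢ k q                               ≈⟨ ⊗-identityˡ (E ^ˢ k q) ⟨
      one ⊗ (E ^ˢ k q)                       ≡⟨ cong (_⊗ (E ^ˢ k q)) (pending-≮ (<-irrefl (sym bq≡1+M))) ⟨
      pending (suc M) q ⊗ (E ^ˢ k q)         ∎

  pending-top : ∀ M → pending (suc M) (suc M) ≡ geomSeries (b * suc M) ^ˢ k (suc M)
  pending-top M = pending-< (subst (suc M <_) (*-comm (suc M) b) (m<m*n (suc M) b b>1))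

  partitionSeries≈truncProd⊗pending : ∀ M → partitionSeries M ≈ˢ truncProd b k M ⊗ pendingProduct M
  partitionSeries≈truncProd⊗pending zero    = ≈ˢ-sym (⊗-identityˡ one)
  partitionSeries≈truncProd⊗pending (suc M) = begin
    partitionSeries M ⊗ E                   ≈⟨ ⊗-congʳ E (partitionSeries≈truncProd⊗pending M) ⟩
    (B ⊗ pendingProduct M) ⊗ E              ≈⟨ ⊗-assoc B (pendingProduct M) E ⟩
    B ⊗ (pendingProduct M ⊗ E)              ≈⟨ ⊗-congˡ B (pendingProduct-step M) ⟩
    B ⊗ (R′ ⊗ (E ^ˢ K))                     ≈⟨ ⊗-congˡ B (⊗-congˡ R′ E^K≈G^K⊗Eb^K) ⟩
    B ⊗ (R′ ⊗ ((G ^ˢ K) ⊗ (Eb ^ˢ K)))       ≈⟨ ⊗-congˡ B (x∙yz≈y∙xz R′ (G ^ˢ K) (Eb ^ˢ K)) ⟩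
    B ⊗ ((G ^ˢ K) ⊗ (R′ ⊗ (Eb ^ˢ K)))       ≈⟨ ⊗-assoc B (G ^ˢ K) (R′ ⊗ (Eb ^ˢ K)) ⟨
    (B ⊗ (G ^ˢ K)) ⊗ (R′ ⊗ (Eb ^ˢ K))       ≡⟨ cong (λ P → (B ⊗ (G ^ˢ K)) ⊗ (R′ ⊗ P)) (pending-top M) ⟨
    truncProd b k (suc M) ⊗ pendingProduct (suc M) ∎
    where
    open SetoidReasoning ≈ˢ-setoid
    K : ℕ
    B E G Eb R′ : Series
    B  = truncProd b k M
    E  = geomSeries (suc M)
    K  = k (suc M)
    G  = geomFactor b (suc M)
    Eb = geomSeries (b * suc M)
    R′ = prodUpTo M (pending (suc M))
    E^K≈G^K⊗Eb^K : E ^ˢ K ≈ˢ (G ^ˢ K) ⊗ (Eb ^ˢ K)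
    E^K≈G^K⊗Eb^K = ≈ˢ-trans (^ˢ-cong K (geomSeries-factor b (suc M) (<⇒≤ b>1) (s≤s z≤n))) (^ˢ-distrib-⊗ G Eb K)

  pendingProduct-one-≤ : ∀ M → pendingProduct M ≈[≤ M ] one
  pendingProduct-one-≤ M = prodUpTo-one-≤ M (pending M) pending-one-≤
    where
    pending-one-≤ : ∀ N → 1 ≤ N → N ≤ M → pending M N ≈[≤ M ] one
    pending-one-≤ N _ _ n n≤M with M <? b * N
    ... | yes M<bN = trans (cong (λ S → S n) (pending-< M<bN)) (^ˢ-one-≤ (k N) (geomSeries-one-≤ M<bN) n n≤M)
    ... | no  M≮bN = cong (λ S → S n) (pending-≮ M≮bN)

  p≡truncProd : ∀ {n M} → n ≤ M → p n ≡ truncProd b k M n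
  p≡truncProd {n} {M} n≤M = begin
    p n                                             ≡⟨ p≡partitionSeries n≤M ⟩
    partitionSeries M n                             ≡⟨ partitionSeries≈truncProd⊗pending M n ⟩
    (truncProd b k M ⊗ pendingProduct M) n          ≡⟨ ⊗-cong-≤ {f = truncProd b k M} (λ _ _ → refl) (pendingProduct-one-≤ M) n n≤M ⟩
    (truncProd b k M ⊗ one) n                       ≡⟨ ⊗-identityʳ (truncProd b k M) n ⟩
    truncProd b k M n                               ∎
    where open ≡-Reasoning

open import Data.Integer using (+_; _-_)
open import Data.Integer.Divisibility using () renaming (_∣_ to _∣ℤ_)
open import Data.Integer.Properties using (+-inverseʳ)

theorem3 : (b : ℕ) → 1 < b → (k : ℕ → ℕ)
         → (∀ N → 1 ≤ N → ∃[ r ] (k N ≡ suc r × (b ^ r) ∣ N × ¬ ((b ^ suc r) ∣ N)))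
         → (n M : ℕ) → n ≤ M
         → (+ b) ∣ℤ ((+ p n) - (+ truncProd b k M n))
theorem3 b b>1 k k≡1+multiplicity n M n≤M
  rewrite sym (p≡truncProd b b>1 k k≡1+multiplicity n≤M)
        | +-inverseʳ (+ p n)
  = b ∣0
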